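{- Let $A$ be a finite nonempty alphabet and $S\subset A^*$ a biextendable set. Let $w\in S$ and $U,V\subset S$. Let $\ell\in S\setminus U$ be such that $\ell w\in S$ and $A\ell\cap S\subset U$, and set $U'=(U\setminus A\ell)\cup\{\ell\}$. If the generalized extension graphs $E_{U',V}(w)$ and $E_{A,V}(\ell w)$ are connected, then $E_{U,V}(w)$ is connected.
   Context: $S$ is biextendable if it contains all factors of its elements and for every $w\in S$ there are letters $a,b$ with $awb\in S$. $A\ell=\{a\ell\mid a\in A\}$. For $w\in S$ and sets of words $U,V$, $U(w)=\{u\in U\mid uw\in S\}$, $V(w)=\{r\in V\mid wr\in S\}$; the generalized extension graph $E_{U,V}(w)$ is the undirected graph with vertex set the disjoint union of a copy of $U(w)$ and a copy of $V(w)$, and an edge $(u,r)$ for $u\in U(w)$, $r\in V(w)$ whenever $uwr\in S$. -}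

module Defs where

open import Data.Nat using (ℕ; suc)
open import Data.Fin using (Fin)
open import Data.List using (List; []; _∷_; _++_)
open import Data.Product using (Σ; ∃; _×_; _,_)
open import Data.Sum using (_⊎_; inj₁; inj₂)
open import Data.Empty using (⊥)
open import Relation.Nullary using (¬_)
open import Relation.Binary.PropositionalEquality using (_≡_)
open import Relation.Binary.Construct.Closure.ReflexiveTransitive using (Star)

-- The alphabet A is a finite nonempty set, represented as Fin (suc k).
Letter : ℕ → Set
Letter k = Fin (suc k)

Word : ℕ → Set
Word k = List (Letter k)

WordSet : ℕ → Set₁
WordSet k = Word k → Set

_⊆_ : ∀ {k} → WordSet k → WordSet k → Set
U ⊆ S = ∀ u → U u → S u

Factor : ∀ {k} → Word k → Word k → Set
Factor {k} w v = Σ (Word k) λ x → Σ (Word k) λ y → v ≡ x ++ (w ++ y)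

Biextendable : ∀ {k} → WordSet k → Set
Biextendable {k} S =
  (∀ v w → S v → Factor w v → S w) ×
  (∀ w → S w → Σ (Letter k) λ a → Σ (Letter k) λ b → S (a ∷ (w ++ (b ∷ []))))

Alph : ∀ {k} → WordSet k
Alph {k} u = Σ (Letter k) λ a → u ≡ a ∷ []

AlphTimes : ∀ {k} → Word k → WordSet k
AlphTimes {k} ℓ u = Σ (Letter k) λ a → u ≡ a ∷ ℓ

Modified : ∀ {k} → WordSet k → Word k → WordSet k
Modified U ℓ u = (U u × ¬ AlphTimes ℓ u) ⊎ u ≡ ℓ

-- Generalized extension graph E_{U,V}(w) (relative to S).
-- Vertices: inj₁ u for u ∈ U(w) (left copy), inj₂ r for r ∈ V(w) (right copy).
IsVertex : ∀ {k} → WordSet k → WordSet k → WordSet k → Word k → Word k ⊎ Word k → Set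
IsVertex S U V w (inj₁ u) = U u × S (u ++ w)
IsVertex S U V w (inj₂ r) = V r × S (w ++ r)

Edge : ∀ {k} → WordSet k → WordSet k → WordSet k → Word k → Word k ⊎ Word k → Word k ⊎ Word k → Set
Edge S U V w (inj₁ u) (inj₂ r) =
  IsVertex S U V w (inj₁ u) × IsVertex S U V w (inj₂ r) × S (u ++ (w ++ r))
Edge S U V w (inj₂ r) (inj₁ u) =
  IsVertex S U V w (inj₁ u) × IsVertex S U V w (inj₂ r) × S (u ++ (w ++ r))
Edge S U V w (inj₁ _) (inj₁ _) = ⊥
Edge S U V w (inj₂ _) (inj₂ _) = ⊥

Connected : ∀ {k} → WordSet k → WordSet k → WordSet k → Word k → Set
Connected S U V w =
  ∀ x y → IsVertex S U V w x → IsVertex S U V w y → Star (Edge S U V w) x y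

module Submission where

-- The words aℓ (a ∈ A) are exactly the left vertices of E_{U,V}(w) that U' collapses to ℓ.
-- The map a ↦ aℓ, r ↦ r is a graph morphism E_{A,V}(ℓw) → E_{U,V}(w), so the image of the
-- connected graph E_{A,V}(ℓw) is a connected cluster containing every aℓ and every right
-- neighbour r of ℓ in E_{U',V}(w). A path in E_{U',V}(w) therefore lifts to E_{U,V}(w)
-- by replacing each visit of ℓ with a detour through that cluster.

open import Defs
open import Level using (Level)
open import Data.Nat using (ℕ)
open import Data.List using ([]; _∷_; _++_)
open import Data.List.Properties using (++-assoc; ++-identityʳ; ≡-dec)
open import Data.Fin.Properties using (_≟_)
open import Data.Product using (∃; _×_; _,_)
open import Data.Sum using (_⊎_; inj₁; inj₂)
open import Data.Empty using (⊥-elim)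
open import Relation.Nullary using (¬_; Dec; yes; no)
open import Relation.Binary.Core using (Rel; REL)
open import Relation.Binary.PropositionalEquality using (_≡_; refl; sym; cong; subst)
open import Relation.Binary.Construct.Closure.ReflexiveTransitive using (Star; ε; _◅_; _◅◅_; gmap)

lift-Star : ∀ {a b r s t : Level} {X : Set a} {Y : Set b} {E : Rel X r} {E′ : Rel Y s}
  (_represents_ : REL X Y t) →
  (∀ {x x′ y} → x represents y → x′ represents y → Star E x x′) →
  (∀ {y y′ x} → E′ y y′ → x represents y → ∃ λ x′ → x′ represents y′ × Star E x x′) →
  ∀ {y y′ x x′} → Star E′ y y′ → x represents y → x′ represents y′ → Star E x x′
lift-Star _ same _ ε rx rx′ = same rx rx′
lift-Star R same step (e ◅ p) rx rx′ with step e rx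
... | m , rm , x⟶m = x⟶m ◅◅ lift-Star R same step p rm rx′

AlphTimes? : ∀ {k} (ℓ u : Word k) → Dec (AlphTimes ℓ u)
AlphTimes? ℓ [] = no λ { (_ , ()) }
AlphTimes? ℓ (a ∷ u) with ≡-dec _≟_ u ℓ
... | yes refl = yes (a , refl)
... | no u≢ℓ = no λ { (_ , refl) → u≢ℓ refl }

module _ {k : ℕ} (S : WordSet k) (factor-closed : ∀ v w → S v → Factor w v → S w) where

  prefix-closed : ∀ u v → S (u ++ v) → S u
  prefix-closed u v s = factor-closed _ u s ([] , v , refl)

  suffix-closed : ∀ u v → S (u ++ v) → S v
  suffix-closed u v s = factor-closed _ v s (u , [] , cong (u ++_) (sym (++-identityʳ v)))

  module Collapse (U V : WordSet k) (w ℓ : Word k) (¬Uℓ : ¬ U ℓ) (Sℓw : S (ℓ ++ w))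
    (Aℓ⊆U : ∀ u → AlphTimes ℓ u → S u → U u) (connectedℓw : Connected S Alph V (ℓ ++ w)) where

    Vertex : Set
    Vertex = Word k ⊎ Word k

    append-ℓ : Vertex → Vertex
    append-ℓ (inj₁ u) = inj₁ (u ++ ℓ)
    append-ℓ (inj₂ r) = inj₂ r

    append-ℓ-vertex : ∀ h → IsVertex S Alph V (ℓ ++ w) h → IsVertex S U V w (append-ℓ h)
    append-ℓ-vertex (inj₁ _) ((a , refl) , s) = Aℓ⊆U (a ∷ ℓ) (a , refl) (prefix-closed (a ∷ ℓ) w s) , s
    append-ℓ-vertex (inj₂ r) (vr , s) =
      vr , suffix-closed ℓ (w ++ r) (subst S (++-assoc ℓ w r) s)

    append-ℓ-word : ∀ u r → u ++ ((ℓ ++ w) ++ r) ≡ (u ++ ℓ) ++ (w ++ r)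
    append-ℓ-word u r rewrite ++-assoc ℓ w r = sym (++-assoc u ℓ (w ++ r))

    append-ℓ-edge : ∀ {h h′} → Edge S Alph V (ℓ ++ w) h h′ → Edge S U V w (append-ℓ h) (append-ℓ h′)
    append-ℓ-edge {inj₁ u} {inj₂ r} (gu , gr , s) =
      append-ℓ-vertex (inj₁ u) gu , append-ℓ-vertex (inj₂ r) gr , subst S (append-ℓ-word u r) s
    append-ℓ-edge {inj₂ r} {inj₁ u} (gu , gr , s) =
      append-ℓ-vertex (inj₁ u) gu , append-ℓ-vertex (inj₂ r) gr , subst S (append-ℓ-word u r) s

    InImage : Vertex → Set
    InImage x = ∃ λ h → IsVertex S Alph V (ℓ ++ w) h × x ≡ append-ℓ h

    image-connected : ∀ {x y} → InImage x → InImage y → Star (Edge S U V w) x y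
    image-connected (h , gh , refl) (h′ , gh′ , refl) =
      gmap append-ℓ append-ℓ-edge (connectedℓw h h′ gh gh′)

    neighbour-of-ℓ-in-image : ∀ r → V r → S (ℓ ++ (w ++ r)) → InImage (inj₂ r)
    neighbour-of-ℓ-in-image r vr s = inj₂ r , (vr , subst S (sym (++-assoc ℓ w r)) s) , refl

    _represents_ : Vertex → Vertex → Set
    x represents z = (IsVertex S U V w x × x ≡ z) ⊎ (z ≡ inj₁ ℓ × InImage x)

    representatives-connected : ∀ {x x′ z} → x represents z → x′ represents z → Star (Edge S U V w) x x′
    representatives-connected (inj₁ (_ , refl)) (inj₁ (_ , refl)) = ε
    representatives-connected (inj₁ ((Uℓ , _) , refl)) (inj₂ (refl , _)) = ⊥-elim (¬Uℓ Uℓ)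
    representatives-connected (inj₂ (refl , _)) (inj₁ ((Uℓ , _) , refl)) = ⊥-elim (¬Uℓ Uℓ)
    representatives-connected (inj₂ (_ , cx)) (inj₂ (_ , cx′)) = image-connected cx cx′

    edge-lifts : ∀ {z z′ x} → Edge S (Modified U ℓ) V w z z′ → x represents z →
      ∃ λ x′ → x′ represents z′ × Star (Edge S U V w) x x′
    edge-lifts {inj₁ u} {inj₂ r} ((inj₁ (Uu , _) , su) , gr , s) (inj₁ (_ , refl)) =
      inj₂ r , inj₁ (gr , refl) , ((Uu , su) , gr , s) ◅ ε
    edge-lifts {inj₁ u} {inj₂ r} ((inj₁ (Uℓ , _) , _) , _) (inj₂ (refl , _)) = ⊥-elim (¬Uℓ Uℓ)
    edge-lifts {inj₁ u} {inj₂ r} ((inj₂ refl , _) , _) (inj₁ ((Uℓ , _) , refl)) = ⊥-elim (¬Uℓ Uℓ)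
    edge-lifts {inj₁ u} {inj₂ r} ((inj₂ refl , _) , (vr , swr) , s) (inj₂ (_ , cx)) =
      inj₂ r , inj₁ ((vr , swr) , refl) , image-connected cx (neighbour-of-ℓ-in-image r vr s)
    edge-lifts {inj₂ r} {inj₁ u} ((inj₁ (Uu , _) , su) , gr , s) (inj₁ (_ , refl)) =
      inj₁ u , inj₁ ((Uu , su) , refl) , ((Uu , su) , gr , s) ◅ ε
    edge-lifts {inj₂ r} {inj₁ u} ((inj₂ refl , _) , (vr , _) , s) (inj₁ (_ , refl)) =
      inj₂ r , inj₂ (refl , neighbour-of-ℓ-in-image r vr s) , ε
    edge-lifts {inj₂ r} {inj₁ u} _ (inj₂ (() , _))
    edge-lifts {inj₁ _} {inj₁ _} ()
    edge-lifts {inj₂ _} {inj₂ _} ()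

    represents-some-vertex : ∀ x → IsVertex S U V w x →
      ∃ λ z → IsVertex S (Modified U ℓ) V w z × x represents z
    represents-some-vertex (inj₂ r) gr = inj₂ r , gr , inj₁ (gr , refl)
    represents-some-vertex (inj₁ u) (Uu , su) with AlphTimes? ℓ u
    ... | yes (a , refl) =
      inj₁ ℓ , (inj₂ refl , Sℓw) , inj₂ (refl , inj₁ (a ∷ []) , ((a , refl) , su) , refl)
    ... | no u∉Aℓ = inj₁ u , (inj₁ (Uu , u∉Aℓ) , su) , inj₁ ((Uu , su) , refl)

    connected-from-collapse : Connected S (Modified U ℓ) V w → Connected S U V w
    connected-from-collapse connected′ x y gx gy with represents-some-vertex x gx | represents-some-vertex y gy
    ... | zx , gzx , rx | zy , gzy , ry =
      lift-Star _represents_ representatives-connected edge-lifts (connected′ zx zy gzx gzy) rx ry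

lemma3p10 : (k : ℕ) (S : WordSet k) → Biextendable S →
    (w : Word k) → S w → (U V : WordSet k) → U ⊆ S → V ⊆ S →
    (ℓ : Word k) → S ℓ → ¬ U ℓ → S (ℓ ++ w) →
    (∀ u → AlphTimes ℓ u → S u → U u) →
    Connected S (Modified U ℓ) V w →
    Connected S Alph V (ℓ ++ w) →
    Connected S U V w
lemma3p10 k S (factor-closed , _) w _ U V _ _ ℓ _ ¬Uℓ Sℓw Aℓ⊆U connected′ connectedℓw =
  Collapse.connected-from-collapse S factor-closed U V w ℓ ¬Uℓ Sℓw Aℓ⊆U connectedℓw connected′
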